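{- Let $\Gamma$ be a group with a linear representation $\rho:\Gamma\to GL(\mathbb{F}^d)$ over a field $\mathbb{F}$, let $G=(V,E)$ be a finite directed graph, and let $\psi,\psi':E\to\Gamma$ be equivalent gain functions on $G$. Then $$\dim_{\mathbb{F}}\operatorname{span}\{A_{e,\psi}\mid e\in E\}=\dim_{\mathbb{F}}\operatorname{span}\{A_{e,\psi'}\mid e\in E\}.$$
   Context: $G$ may have loops and parallel edges; a gain function $\psi:E\to\Gamma$ assigns to each oriented edge a group element, reversing orientation inverts the gain. A switching at a vertex $v$ with $g\in\Gamma$ replaces $\psi$ by $\psi'$ where $\psi'(e)=g\psi(e)$ if $e$ is a non-loop edge directed out of $v$, $\psi'(e)=\psi(e)g^{ -1}$ if $e$ is a non-loop edge directed into $v$, $\psi'(e)=g\psi(e)g^{ -1}$ if $e$ is a loop at $v$, and $\psi'(e)=\psi(e)$ otherwise. Two gain functions are equivalent if one is obtained from the other by a sequence of switchings. For $x\in(\mathbb{F}^d)^V$ and $W\subseteq V$, $x(W)=0$ means $x(w)=0$ for all $w\in W$. For a non-loop edge $e$ directed from $i$ to $j$, $A_{e,\psi}=\{x\in(\mathbb{F}^d)^V : x(i)+\rho(\psi(e))x(j)=0,\ x(V\setminus\{i,j\})=0\}$; for a loop $e$ at $i$, $A_{e,\psi}=\{x\in(\mathbb{F}^d)^V : \exists\alpha\in\mathbb{F}^d,\ x(i)=(I_d-\rho(\psi(e)))\alpha,\ x(V\setminus\{i\})=0\}$. -}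

module Defs where

open import Level using (Level; _⊔_; suc)
open import Data.Nat using (ℕ; zero) renaming (suc to sucℕ)
open import Data.Fin using (Fin; _≟_)
open import Data.List using (List; []; _∷_)
open import Data.Product using (Σ; ∃; _×_; _,_; proj₁; proj₂)
open import Relation.Nullary using (¬_; yes; no)
open import Relation.Binary.PropositionalEquality using (_≡_)
open import Relation.Binary.Construct.Closure.ReflexiveTransitive using (Star)
open import Algebra.Bundles using (CommutativeRing; Group)
open import Data.List.Relation.Unary.All using (All)
open import Data.Sum using (_⊎_)
open import Level using (Lift)

record Field (c ℓ : Level) : Set (Level.suc (c ⊔ ℓ)) where
  field
    commutativeRing : CommutativeRing c ℓ
  open CommutativeRing commutativeRing public
  field
    0≉1     : ¬ (0# ≈ 1#)
    inverse : ∀ x → ¬ (x ≈ 0#) → Σ Carrier λ y → x * y ≈ 1#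

module _ {c ℓ : Level} (F : Field c ℓ) where
  open Field F

  ∑ : (n : ℕ) → (Fin n → Carrier) → Carrier
  ∑ zero    f = 0#
  ∑ (sucℕ n) f = f Fin.zero + ∑ n (λ i → f (Fin.suc i))

  Matrix : ℕ → Set c
  Matrix d = Fin d → Fin d → Carrier

  identity : (d : ℕ) → Matrix d
  identity d i j with i ≟ j
  ... | yes _ = 1#
  ... | no  _ = 0#

  _·ᴹ_ : {d : ℕ} → Matrix d → Matrix d → Matrix d
  _·ᴹ_ {d} M N i j = ∑ d (λ k → M i k * N k j)

  _≈ᴹ_ : {d : ℕ} → Matrix d → Matrix d → Set ℓ
  M ≈ᴹ N = ∀ i j → M i j ≈ N i j

  apply : {d : ℕ} → Matrix d → (Fin d → Carrier) → (Fin d → Carrier)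
  apply {d} M v i = ∑ d (λ j → M i j * v j)

  -- A linear representation ρ : Γ → GL(F^d): a group homomorphism into
  -- d×d matrices (invertibility of ρ g follows from the homomorphism laws).
  record Representation {a b : Level} (Γ : Group a b) (d : ℕ)
         : Set (a ⊔ b ⊔ c ⊔ ℓ) where
    private module Γ = Group Γ
    field
      ρ      : Γ.Carrier → Matrix d
      ρ-cong : ∀ {g h} → g Γ.≈ h → ρ g ≈ᴹ ρ h
      ρ-ε    : ρ Γ.ε ≈ᴹ identity d
      ρ-∙    : ∀ g h → ρ (g Γ.∙ h) ≈ᴹ (ρ g ·ᴹ ρ h)

  module LinAlg {i : Level} (I : Set i) where
    Vect : Set (i ⊔ c)
    Vect = I → Carrier

    _≈ᵛ_ : Vect → Vect → Set (i ⊔ ℓ)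
    u ≈ᵛ v = ∀ k → u k ≈ v k

    zeroᵛ : Vect
    zeroᵛ _ = 0#

    _+ᵛ_ : Vect → Vect → Vect
    (u +ᵛ v) k = u k + v k

    _•_ : Carrier → Vect → Vect
    (a • v) k = a * v k

    lincomb : List (Carrier × Vect) → Vect
    lincomb []             = zeroᵛ
    lincomb ((a , v) ∷ xs) = (a • v) +ᵛ lincomb xs

    Span : ∀ {p} → (Vect → Set p) → Vect → Set (i ⊔ c ⊔ ℓ ⊔ p)
    Span P x = Σ (List (Carrier × Vect)) λ xs →
                 All (λ av → P (proj₂ av)) xs × (x ≈ᵛ lincomb xs)

    lincombFin : (n : ℕ) → (Fin n → Carrier) → (Fin n → Vect) → Vect
    lincombFin n a b k = ∑ n (λ m → a m * b m k)

    HasDim : ∀ {p} → (Vect → Set p) → ℕ → Set (i ⊔ c ⊔ ℓ ⊔ p)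
    HasDim W n = Σ (Fin n → Vect) λ b →
        (∀ m → W (b m))
      × (∀ a → lincombFin n a b ≈ᵛ zeroᵛ → ∀ m → a m ≈ 0#)
      × (∀ x → W x → Σ (Fin n → Carrier) λ a → x ≈ᵛ lincombFin n a b)

-- Gain graphs: G = (V, E) finite directed multigraph with loops,
-- V = Fin nV, E = Fin nE, edge e oriented from src e to tgt e
-- (a loop when src e ≡ tgt e). A gain function assigns ψ e ∈ Γ to e in
-- its given orientation (the reversed orientation gets ψ e ⁻¹).
module _ {a b : Level} (Γ : Group a b) {nV nE : ℕ}
         (src tgt : Fin nE → Fin nV) where
  open Group Γ

  GainFunction : Set a
  GainFunction = Fin nE → Carrier

  switch : Fin nV → Carrier → GainFunction → GainFunction
  switch v g ψ e with src e ≟ v | tgt e ≟ v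
  ... | yes _ | yes _ = (g ∙ ψ e) ∙ (g ⁻¹)
  ... | yes _ | no  _ = g ∙ ψ e
  ... | no  _ | yes _ = ψ e ∙ (g ⁻¹)
  ... | no  _ | no  _ = ψ e

  SwitchStep : GainFunction → GainFunction → Set (a ⊔ b)
  SwitchStep ψ ψ' = Σ (Fin nV) λ v → Σ Carrier λ g →
                      ∀ e → ψ' e ≈ switch v g ψ e

  Equivalent : GainFunction → GainFunction → Set (a ⊔ b)
  Equivalent = Star SwitchStep

module _ {c ℓ a b : Level} (F : Field c ℓ) (Γ : Group a b) (d : ℕ)
         (R : Representation F Γ d) {nV nE : ℕ}
         (src tgt : Fin nE → Fin nV) where
  open Field F
  open Representation R
  open LinAlg F (Fin nV × Fin d)

  -- x ∈ (F^d)^V represented as a function on V × {1..d}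
  at : Vect → Fin nV → Fin d → Carrier
  at x v k = x (v , k)

  vanishesOutside : (Fin nV → Set) → Vect → Set ℓ
  vanishesOutside S x = ∀ v → ¬ S v → ∀ k → at x v k ≈ 0#

  A : GainFunction Γ src tgt → Fin nE → Vect → Set (c ⊔ ℓ)
  A ψ e x with src e ≟ tgt e
  ... | yes _ =
    Σ (Fin d → Carrier) (λ α →
      (∀ k → at x (src e) k ≈ apply F (λ p q → identity F d p q - ρ (ψ e) p q) α k))
    × vanishesOutside (λ v → v ≡ src e) x
  ... | no _ =
    Lift c ((∀ k → at x (src e) k + apply F (ρ (ψ e)) (at x (tgt e)) k ≈ 0#)
    × vanishesOutside (λ v → (v ≡ src e) ⊎ (v ≡ tgt e)) x)

  SpanA : GainFunction Γ src tgt → Vect → Set (c ⊔ ℓ)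
  SpanA ψ = Span (λ x → Σ (Fin nE) λ e → A ψ e x)

  DimSpanA : GainFunction Γ src tgt → ℕ → Set (c ⊔ ℓ)
  DimSpanA ψ n = HasDim (SpanA ψ) n

module Submission where

open import Defs
open import Level using (Level; _⊔_; lift)
open import Data.Nat using (ℕ; zero; suc)
open import Data.Fin using (Fin; _≟_; punchIn)
open import Data.Fin.Properties using (punchInᵢ≢i)
open import Data.Vec.Functional using (replicate)
open import Data.List using ([]; _∷_; map)
open import Data.List.Relation.Unary.All using (All; []; _∷_)
open import Data.Product using (Σ; _×_; _,_; proj₂)
open import Function using (_∘_)
open import Function.Bundles using (_⇔_; mk⇔)
open import Function.Properties.Equivalence using (⇔-isEquivalence)
open import Relation.Nullary using (yes; no)
open import Relation.Nullary.Negation using (contradiction)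
open import Relation.Binary.Structures using (IsEquivalence)
open import Relation.Binary.PropositionalEquality as ≡ using (_≡_; _≢_)
import Relation.Binary.Construct.Closure.ReflexiveTransitive as Star
open import Algebra.Bundles using (Group)
import Algebra.Properties.Semiring.Sum

-- Switching at v with g is realised on (F^d)^V by the linear automorphism applying ρ(g) to the
-- v-coordinate (undone by switching with g⁻¹), and it carries each A_{e,ψ} into A_{e,ψ'}: for a
-- non-loop edge, x(i) + ρ(h) x(j) = 0 becomes ρ(g)x(i) + ρ(gh) x(j) = 0 or
-- x(i) + ρ(hg⁻¹) ρ(g)x(j) = 0, and for a loop at v, ρ(g)(I − ρ(h))α = (I − ρ(ghg⁻¹)) ρ(g)α.
-- A linear automorphism mapping one span onto the other preserves its dimension, and equivalent
-- gain functions are joined by a finite chain of switchings.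

module FiniteSums {c ℓ : Level} (F : Field c ℓ) where
  open Field F
  open import Algebra.Properties.Ring ring using (-1*x≈-x)
  open import Relation.Binary.Reasoning.Setoid setoid
  module Sum = Algebra.Properties.Semiring.Sum semiring
  open Sum using (sum; sum-cong-≋)

  ∑≈sum : ∀ n (f : Fin n → Carrier) → ∑ F n f ≈ sum f
  ∑≈sum zero    f = refl
  ∑≈sum (suc n) f = +-congˡ (∑≈sum n (f ∘ Fin.suc))

  ∑-cong : ∀ n {f g : Fin n → Carrier} → (∀ i → f i ≈ g i) → ∑ F n f ≈ ∑ F n g
  ∑-cong n {f} {g} f≈g = begin
    ∑ F n f ≈⟨ ∑≈sum n f ⟩
    sum f   ≈⟨ sum-cong-≋ f≈g ⟩
    sum g   ≈⟨ ∑≈sum n g ⟨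
    ∑ F n g ∎

  ∑-distrib-+ : ∀ n (f g : Fin n → Carrier) →
                ∑ F n (λ i → f i + g i) ≈ ∑ F n f + ∑ F n g
  ∑-distrib-+ n f g = begin
    ∑ F n (λ i → f i + g i) ≈⟨ ∑≈sum n _ ⟩
    sum (λ i → f i + g i)   ≈⟨ Sum.∑-distrib-+ f g ⟩
    sum f + sum g           ≈⟨ +-cong (∑≈sum n f) (∑≈sum n g) ⟨
    ∑ F n f + ∑ F n g       ∎

  ∑-distribˡ-* : ∀ n a (f : Fin n → Carrier) → ∑ F n (λ i → a * f i) ≈ a * ∑ F n f
  ∑-distribˡ-* n a f = begin
    ∑ F n (λ i → a * f i) ≈⟨ ∑≈sum n _ ⟩
    sum (λ i → a * f i)   ≈⟨ Sum.*-distribˡ-sum a f ⟨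
    a * sum f             ≈⟨ *-congˡ (∑≈sum n f) ⟨
    a * ∑ F n f           ∎

  ∑-distribʳ-* : ∀ n a (f : Fin n → Carrier) → ∑ F n (λ i → f i * a) ≈ ∑ F n f * a
  ∑-distribʳ-* n a f = begin
    ∑ F n (λ i → f i * a) ≈⟨ ∑≈sum n _ ⟩
    sum (λ i → f i * a)   ≈⟨ Sum.*-distribʳ-sum a f ⟨
    sum f * a             ≈⟨ *-congʳ (∑≈sum n f) ⟨
    ∑ F n f * a           ∎

  ∑-neg : ∀ n (f : Fin n → Carrier) → ∑ F n (λ i → - f i) ≈ - ∑ F n f
  ∑-neg n f = begin
    ∑ F n (λ i → - f i)     ≈⟨ ∑-cong n (λ i → -1*x≈-x (f i)) ⟨
    ∑ F n (λ i → - 1# * f i) ≈⟨ ∑-distribˡ-* n (- 1#) f ⟩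
    - 1# * ∑ F n f          ≈⟨ -1*x≈-x _ ⟩
    - ∑ F n f               ∎

  ∑-comm : ∀ m n (f : Fin m → Fin n → Carrier) →
           ∑ F m (λ i → ∑ F n (f i)) ≈ ∑ F n (λ j → ∑ F m (λ i → f i j))
  ∑-comm m n f = begin
    ∑ F m (λ i → ∑ F n (f i))          ≈⟨ ∑-cong m (λ i → ∑≈sum n (f i)) ⟩
    ∑ F m (λ i → sum (f i))            ≈⟨ ∑≈sum m _ ⟩
    sum (λ i → sum (f i))              ≈⟨ Sum.∑-comm f ⟩
    sum (λ j → sum (λ i → f i j))      ≈⟨ ∑≈sum n _ ⟨
    ∑ F n (λ j → sum (λ i → f i j))    ≈⟨ ∑-cong n (λ j → ∑≈sum m _) ⟨
    ∑ F n (λ j → ∑ F m (λ i → f i j))  ∎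

  ∑-single : ∀ n (i : Fin n) {f : Fin n → Carrier} →
             (∀ j → j ≢ i → f j ≈ 0#) → ∑ F n f ≈ f i
  ∑-single (suc n) i {f} off-i = begin
    ∑ F (suc n) f                      ≈⟨ ∑≈sum (suc n) f ⟩
    sum f                              ≈⟨ Sum.sum-remove f ⟩
    f i + sum (λ j → f (punchIn i j))  ≈⟨ +-congˡ (sum-cong-≋ (λ j → off-i _ (punchInᵢ≢i i j))) ⟩
    f i + sum (replicate n 0#)         ≈⟨ +-congˡ (Sum.sum-replicate-zero n) ⟩
    f i + 0#                           ≈⟨ +-identityʳ (f i) ⟩
    f i                                ∎

module LinearMaps {c ℓ : Level} (F : Field c ℓ) {i : Level} (I : Set i) where
  open Field F
  open LinAlg F I
  open import Algebra.Properties.Ring ring using (-1*x≈-x)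
  open import Relation.Binary.Reasoning.Setoid setoid

  record IsLinear (f : Vect → Vect) : Set (i ⊔ c ⊔ ℓ) where
    field
      cong   : ∀ {x y} → x ≈ᵛ y → f x ≈ᵛ f y
      +-homo : ∀ x y → f (x +ᵛ y) ≈ᵛ (f x +ᵛ f y)
      •-homo : ∀ a x → f (a • x) ≈ᵛ (a • f x)

    0-homo : f zeroᵛ ≈ᵛ zeroᵛ
    0-homo k = begin
      f zeroᵛ k         ≈⟨ cong (λ k → sym (zeroˡ 0#)) k ⟩
      f (0# • zeroᵛ) k  ≈⟨ •-homo 0# zeroᵛ k ⟩
      0# * f zeroᵛ k    ≈⟨ zeroˡ _ ⟩
      0#                ∎

    neg-homo : ∀ x → f (λ k → - x k) ≈ᵛ (λ k → - f x k)
    neg-homo x k = begin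
      f (λ k → - x k) k  ≈⟨ cong (λ k → sym (-1*x≈-x (x k))) k ⟩
      f ((- 1#) • x) k   ≈⟨ •-homo (- 1#) x k ⟩
      - 1# * f x k       ≈⟨ -1*x≈-x (f x k) ⟩
      - f x k            ∎

    lincomb-homo : ∀ xs → f (lincomb xs) ≈ᵛ lincomb (map (λ (a , x) → a , f x) xs)
    lincomb-homo []             = 0-homo
    lincomb-homo ((a , x) ∷ xs) k =
      trans (+-homo (a • x) (lincomb xs) k) (+-cong (•-homo a x k) (lincomb-homo xs k))

    lincombFin-homo : ∀ n a b → f (lincombFin n a b) ≈ᵛ lincombFin n a (f ∘ b)
    lincombFin-homo zero    a b = 0-homo
    lincombFin-homo (suc n) a b k =
      trans (+-homo _ (lincombFin n (a ∘ Fin.suc) (b ∘ Fin.suc)) k)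
            (+-cong (•-homo _ _ k) (lincombFin-homo n (a ∘ Fin.suc) (b ∘ Fin.suc) k))

  Span-map : ∀ {p q} {P : Vect → Set p} {Q : Vect → Set q} {f : Vect → Vect} →
             IsLinear f → (∀ x → P x → Q (f x)) → ∀ x → Span P x → Span Q (f x)
  Span-map {P = P} {Q} {f} f-lin P⇒Q x (xs , xs∈P , x≈) =
    map (λ (a , y) → a , f y) xs , All-map xs xs∈P , λ k → trans (cong x≈ k) (lincomb-homo xs k)
    where
    open IsLinear f-lin
    All-map : ∀ ys → All (P ∘ proj₂) ys → All (Q ∘ proj₂) (map (λ (a , y) → a , f y) ys)
    All-map []            []            = []
    All-map ((_ , y) ∷ ys) (y∈P ∷ ys∈P) = P⇒Q y y∈P ∷ All-map ys ys∈P

  module _ {p q} {W : Vect → Set p} {W′ : Vect → Set q} {f g : Vect → Vect}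
           (f-lin : IsLinear f) (g-lin : IsLinear g)
           (g∘f≈id : ∀ x → g (f x) ≈ᵛ x) (f∘g≈id : ∀ x → f (g x) ≈ᵛ x)
           (f-maps : ∀ x → W x → W′ (f x)) (g-maps : ∀ x → W′ x → W (g x)) where

    HasDim-image : ∀ n → HasDim W n → HasDim W′ n
    HasDim-image n (b , b∈W , independent , spanning) =
      f ∘ b , (λ m → f-maps (b m) (b∈W m)) , independent′ , spanning′
      where
      independent′ : ∀ a → lincombFin n a (f ∘ b) ≈ᵛ zeroᵛ → ∀ m → a m ≈ 0#
      independent′ a fb≈0 = independent a λ k → begin
        lincombFin n a b k             ≈⟨ g∘f≈id _ k ⟨
        g (f (lincombFin n a b)) k     ≈⟨ IsLinear.cong g-lin (IsLinear.lincombFin-homo f-lin n a b) k ⟩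
        g (lincombFin n a (f ∘ b)) k   ≈⟨ IsLinear.cong g-lin fb≈0 k ⟩
        g zeroᵛ k                      ≈⟨ IsLinear.0-homo g-lin k ⟩
        0#                             ∎
      spanning′ : ∀ x → W′ x → Σ (Fin n → Carrier) λ a → x ≈ᵛ lincombFin n a (f ∘ b)
      spanning′ x x∈W′ with spanning (g x) (g-maps x x∈W′)
      ... | a , gx≈ = a , λ k → begin
        x k                         ≈⟨ f∘g≈id x k ⟨
        f (g x) k                   ≈⟨ IsLinear.cong f-lin gx≈ k ⟩
        f (lincombFin n a b) k      ≈⟨ IsLinear.lincombFin-homo f-lin n a b k ⟩
        lincombFin n a (f ∘ b) k    ∎

  HasDim-transport : ∀ {p q} {W : Vect → Set p} {W′ : Vect → Set q} {f g : Vect → Vect} →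
    IsLinear f → IsLinear g → (∀ x → g (f x) ≈ᵛ x) → (∀ x → f (g x) ≈ᵛ x) →
    (∀ x → W x → W′ (f x)) → (∀ x → W′ x → W (g x)) → ∀ n → HasDim W n ⇔ HasDim W′ n
  HasDim-transport f-lin g-lin g∘f≈id f∘g≈id f-maps g-maps n =
    mk⇔ (HasDim-image f-lin g-lin g∘f≈id f∘g≈id f-maps g-maps n)
        (HasDim-image g-lin f-lin f∘g≈id g∘f≈id g-maps f-maps n)

module MatrixAction {c ℓ : Level} (F : Field c ℓ) {d : ℕ} where
  open Field F
  open FiniteSums F
  open LinAlg F (Fin d)
  open LinearMaps F (Fin d)
  open import Algebra.Properties.Ring ring using (-‿distribˡ-*)
  open import Relation.Binary.Reasoning.Setoid setoid

  I-_ : Matrix F d → Matrix F d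
  (I- M) p q = identity F d p q - M p q

  apply-cong : ∀ {M N : Matrix F d} {u w} → (∀ i j → M i j ≈ N i j) → u ≈ᵛ w →
               apply F M u ≈ᵛ apply F N w
  apply-cong M≈N u≈w i = ∑-cong d (λ j → *-cong (M≈N i j) (u≈w j))

  apply-linear : ∀ M → IsLinear (apply F M)
  apply-linear M = record
    { cong   = apply-cong {M} (λ _ _ → refl)
    ; +-homo = λ u w i → trans (∑-cong d (λ j → distribˡ _ _ _)) (∑-distrib-+ d _ _)
    ; •-homo = λ a u i → trans (∑-cong d (λ j → x*[a*y]≈a*[x*y] (M i j) a (u j)))
                               (∑-distribˡ-* d a _)
    }
    where
    x*[a*y]≈a*[x*y] : ∀ x a y → x * (a * y) ≈ a * (x * y)
    x*[a*y]≈a*[x*y] x a y =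
      trans (sym (*-assoc x a y)) (trans (*-congʳ (*-comm x a)) (*-assoc a x y))

  apply-identity : ∀ u → apply F (identity F d) u ≈ᵛ u
  apply-identity u i = trans (∑-single d i off-diagonal) (trans (*-congʳ diagonal) (*-identityˡ (u i)))
    where
    diagonal : identity F d i i ≈ 1#
    diagonal with i ≟ i
    ... | yes _   = refl
    ... | no  i≢i = contradiction ≡.refl i≢i
    off-diagonal : ∀ j → j ≢ i → identity F d i j * u j ≈ 0#
    off-diagonal j j≢i with i ≟ j
    ... | yes i≡j = contradiction (≡.sym i≡j) j≢i
    ... | no  _   = zeroˡ (u j)

  apply-·ᴹ : ∀ M N u → apply F (_·ᴹ_ F M N) u ≈ᵛ apply F M (apply F N u)
  apply-·ᴹ M N u i = begin
    ∑ F d (λ j → ∑ F d (λ k → M i k * N k j) * u j)   ≈⟨ ∑-cong d (λ j → ∑-distribʳ-* d (u j) _) ⟨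
    ∑ F d (λ j → ∑ F d (λ k → M i k * N k j * u j))   ≈⟨ ∑-comm d d _ ⟨
    ∑ F d (λ k → ∑ F d (λ j → M i k * N k j * u j))   ≈⟨ ∑-cong d (λ k → ∑-cong d (λ j → *-assoc _ _ _)) ⟩
    ∑ F d (λ k → ∑ F d (λ j → M i k * (N k j * u j))) ≈⟨ ∑-cong d (λ k → ∑-distribˡ-* d (M i k) _) ⟩
    ∑ F d (λ k → M i k * ∑ F d (λ j → N k j * u j))   ∎

  apply-I- : ∀ M u i → apply F (I- M) u i ≈ u i - apply F M u i
  apply-I- M u i = begin
    ∑ F d (λ j → (identity F d i j - M i j) * u j)
      ≈⟨ ∑-cong d (λ j → trans (distribʳ _ _ _) (+-congˡ (sym (-‿distribˡ-* _ _)))) ⟩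
    ∑ F d (λ j → identity F d i j * u j + - (M i j * u j))
      ≈⟨ ∑-distrib-+ d _ _ ⟩
    apply F (identity F d) u i + ∑ F d (λ j → - (M i j * u j))
      ≈⟨ +-cong (apply-identity u i) (∑-neg d _) ⟩
    u i - apply F M u i ∎

module RepresentationAction {c ℓ a b : Level} (F : Field c ℓ) (Γ : Group a b) {d : ℕ}
                            (R : Representation F Γ d) where
  open Field F
  private module Γ = Group Γ
  open Representation R
  open LinAlg F (Fin d)
  open LinearMaps F (Fin d)
  open MatrixAction F {d}
  open import Relation.Binary.Reasoning.Setoid setoid

  act : Γ.Carrier → Vect → Vect
  act g = apply F (ρ g)

  act-cong : ∀ {g h u w} → g Γ.≈ h → u ≈ᵛ w → act g u ≈ᵛ act h w
  act-cong g≈h = apply-cong (ρ-cong g≈h)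

  act-linear : ∀ g → IsLinear (act g)
  act-linear g = apply-linear (ρ g)

  module Act g = IsLinear (act-linear g)

  act-∙ : ∀ g h u → act (g Γ.∙ h) u ≈ᵛ act g (act h u)
  act-∙ g h u i = trans (apply-cong (ρ-∙ g h) (λ _ → refl) i) (apply-·ᴹ (ρ g) (ρ h) u i)

  act-cancel : ∀ {g h} → h Γ.∙ g Γ.≈ Γ.ε → ∀ u → act h (act g u) ≈ᵛ u
  act-cancel {g} {h} hg≈ε u i = begin
    act h (act g u) i   ≈⟨ act-∙ h g u i ⟨
    act (h Γ.∙ g) u i   ≈⟨ apply-cong (λ p q → trans (ρ-cong hg≈ε p q) (ρ-ε p q)) (λ _ → refl) i ⟩
    apply F (identity F d) u i ≈⟨ apply-identity u i ⟩
    u i                 ∎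

  I-ρ-cong : ∀ {h h′} → h Γ.≈ h′ → ∀ u → apply F (I- ρ h) u ≈ᵛ apply F (I- ρ h′) u
  I-ρ-cong {h} {h′} h≈h′ u =
    apply-cong {I- ρ h} {I- ρ h′} (λ p q → +-congˡ (-‿cong (ρ-cong h≈h′ p q))) (λ _ → refl)

  act-conjugate : ∀ g h u → act ((g Γ.∙ h) Γ.∙ g Γ.⁻¹) (act g u) ≈ᵛ act g (act h u)
  act-conjugate g h u i = begin
    act ((g Γ.∙ h) Γ.∙ g Γ.⁻¹) (act g u) i   ≈⟨ act-∙ (g Γ.∙ h) (g Γ.⁻¹) (act g u) i ⟩
    act (g Γ.∙ h) (act (g Γ.⁻¹) (act g u)) i ≈⟨ act-cong Γ.refl (act-cancel (Γ.inverseˡ g) u) i ⟩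
    act (g Γ.∙ h) u i                        ≈⟨ act-∙ g h u i ⟩
    act g (act h u) i                        ∎

  act-I- : ∀ {g h h′} → h′ Γ.≈ (g Γ.∙ h) Γ.∙ g Γ.⁻¹ →
           ∀ u → act g (apply F (I- ρ h) u) ≈ᵛ apply F (I- ρ h′) (act g u)
  act-I- {g} {h} {h′} h′≈ u i = begin
    act g (apply F (I- ρ h) u) i              ≈⟨ Act.cong g (apply-I- (ρ h) u) i ⟩
    act g (λ j → u j - act h u j) i           ≈⟨ Act.+-homo g u _ i ⟩
    act g u i + act g (λ j → - act h u j) i   ≈⟨ +-congˡ (Act.neg-homo g (act h u) i) ⟩
    act g u i - act g (act h u) i             ≈⟨ +-congˡ (-‿cong (act-conjugate g h u i)) ⟨
    act g u i - act ((g Γ.∙ h) Γ.∙ g Γ.⁻¹) (act g u) i ≈⟨ +-congˡ (-‿cong (act-cong h′≈ (λ _ → refl) i)) ⟨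
    act g u i - act h′ (act g u) i            ≈⟨ apply-I- (ρ h′) (act g u) i ⟨
    apply F (I- ρ h′) (act g u) i             ∎

  Balanced : Γ.Carrier → Vect → Vect → Set ℓ
  Balanced h u w = (u +ᵛ act h w) ≈ᵛ zeroᵛ

  Balanced-cong : ∀ {h h′ u u′ w w′} → h′ Γ.≈ h → u′ ≈ᵛ u → w′ ≈ᵛ w →
                  Balanced h u w → Balanced h′ u′ w′
  Balanced-cong h′≈h u′≈u w′≈w bal i = trans (+-cong (u′≈u i) (act-cong h′≈h w′≈w i)) (bal i)

  Balanced-∙ˡ : ∀ {g h h′ u w} → h′ Γ.≈ g Γ.∙ h → Balanced h u w → Balanced h′ (act g u) w
  Balanced-∙ˡ {g} {h} {h′} {u} {w} h′≈ bal i = begin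
    act g u i + act h′ w i            ≈⟨ +-congˡ (act-cong h′≈ (λ _ → refl) i) ⟩
    act g u i + act (g Γ.∙ h) w i     ≈⟨ +-congˡ (act-∙ g h w i) ⟩
    act g u i + act g (act h w) i     ≈⟨ Act.+-homo g u (act h w) i ⟨
    act g (u +ᵛ act h w) i            ≈⟨ Act.cong g bal i ⟩
    act g zeroᵛ i                     ≈⟨ Act.0-homo g i ⟩
    0#                                ∎

  Balanced-∙⁻¹ʳ : ∀ {g h h′ u w} → h′ Γ.≈ h Γ.∙ g Γ.⁻¹ → Balanced h u w → Balanced h′ u (act g w)
  Balanced-∙⁻¹ʳ {g} {h} {h′} {u} {w} h′≈ bal i = begin
    u i + act h′ (act g w) i                   ≈⟨ +-congˡ (act-cong h′≈ (λ _ → refl) i) ⟩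
    u i + act (h Γ.∙ g Γ.⁻¹) (act g w) i       ≈⟨ +-congˡ (act-∙ h (g Γ.⁻¹) (act g w) i) ⟩
    u i + act h (act (g Γ.⁻¹) (act g w)) i     ≈⟨ +-congˡ (act-cong Γ.refl (act-cancel (Γ.inverseˡ g) w) i) ⟩
    u i + act h w i                            ≈⟨ bal i ⟩
    0#                                         ∎

module Switching {a b : Level} (Γ : Group a b) {nV nE : ℕ} (src tgt : Fin nE → Fin nV) where
  open Group Γ
  open import Algebra.Properties.Group Γ using (⁻¹-involutive; \\-leftDividesʳ; //-rightDividesˡ)
  open import Relation.Binary.Reasoning.Setoid setoid

  switch-inverse : ∀ v g {ψ ψ′ : GainFunction Γ src tgt} e →
                   ψ′ e ≈ switch Γ src tgt v g ψ e → ψ e ≈ switch Γ src tgt v (g ⁻¹) ψ′ e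
  switch-inverse v g {ψ} {ψ′} e ψ′e≈ with src e ≟ v | tgt e ≟ v
  ... | yes _ | yes _ = sym (begin
    g ⁻¹ ∙ ψ′ e ∙ g ⁻¹ ⁻¹                 ≈⟨ ∙-cong (∙-congˡ ψ′e≈) (⁻¹-involutive g) ⟩
    g ⁻¹ ∙ ((g ∙ ψ e) ∙ g ⁻¹) ∙ g         ≈⟨ ∙-congʳ (sym (assoc _ _ _)) ⟩
    g ⁻¹ ∙ (g ∙ ψ e) ∙ g ⁻¹ ∙ g           ≈⟨ ∙-congʳ (∙-congʳ (\\-leftDividesʳ g (ψ e))) ⟩
    ψ e ∙ g ⁻¹ ∙ g                        ≈⟨ //-rightDividesˡ g (ψ e) ⟩
    ψ e                                   ∎)
  ... | yes _ | no  _ = sym (trans (∙-congˡ ψ′e≈) (\\-leftDividesʳ g (ψ e)))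
  ... | no  _ | yes _ =
    sym (trans (∙-cong ψ′e≈ (⁻¹-involutive g)) (//-rightDividesˡ g (ψ e)))
  ... | no  _ | no  _ = sym ψ′e≈

module SwitchingAction {c ℓ a b : Level} (F : Field c ℓ) (Γ : Group a b) (d : ℕ)
                       (R : Representation F Γ d) {nV nE : ℕ} (src tgt : Fin nE → Fin nV) where
  open Field F
  private module Γ = Group Γ
  open Representation R
  open RepresentationAction F Γ R
  open LinAlg F (Fin nV × Fin d)
  open LinearMaps F (Fin nV × Fin d)
  open Switching Γ src tgt

  switchᵛ : Fin nV → Γ.Carrier → Vect → Vect
  switchᵛ v g x (w , k) with w ≟ v
  ... | yes _ = act g (λ j → x (w , j)) k
  ... | no  _ = x (w , k)

  module _ {v : Fin nV} (g : Γ.Carrier) (x : Vect) {w : Fin nV} where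
    switchᵛ-at : w ≡ v → ∀ k → switchᵛ v g x (w , k) ≈ act g (λ j → x (w , j)) k
    switchᵛ-at w≡v k with w ≟ v
    ... | yes _   = refl
    ... | no  w≢v = contradiction w≡v w≢v

    switchᵛ-away : w ≢ v → ∀ k → switchᵛ v g x (w , k) ≈ x (w , k)
    switchᵛ-away w≢v k with w ≟ v
    ... | yes w≡v = contradiction w≡v w≢v
    ... | no  _   = refl

  switchᵛ-linear : ∀ v g → IsLinear (switchᵛ v g)
  switchᵛ-linear v g = record { cong = cong′ ; +-homo = +-homo′ ; •-homo = •-homo′ }
    where
    cong′ : ∀ {x y} → x ≈ᵛ y → switchᵛ v g x ≈ᵛ switchᵛ v g y
    cong′ x≈y (w , k) with w ≟ v
    ... | yes _ = act-cong Γ.refl (λ j → x≈y (w , j)) k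
    ... | no  _ = x≈y (w , k)
    +-homo′ : ∀ x y → switchᵛ v g (x +ᵛ y) ≈ᵛ (switchᵛ v g x +ᵛ switchᵛ v g y)
    +-homo′ x y (w , k) with w ≟ v
    ... | yes _ = Act.+-homo g _ _ k
    ... | no  _ = refl
    •-homo′ : ∀ s x → switchᵛ v g (s • x) ≈ᵛ (s • switchᵛ v g x)
    •-homo′ s x (w , k) with w ≟ v
    ... | yes _ = Act.•-homo g s _ k
    ... | no  _ = refl

  switchᵛ-cancel : ∀ v {g h} → h Γ.∙ g Γ.≈ Γ.ε → ∀ x → switchᵛ v h (switchᵛ v g x) ≈ᵛ x
  switchᵛ-cancel v {g} {h} hg≈ε x (w , k) with w ≟ v
  ... | yes w≡v = trans (act-cong Γ.refl (switchᵛ-at g x w≡v) k) (act-cancel hg≈ε _ k)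
  ... | no  w≢v = switchᵛ-away g x w≢v k

  switchᵛ-vanishesOutside : ∀ v g {S} {x} → vanishesOutside F Γ d R src tgt S x →
                            vanishesOutside F Γ d R src tgt S (switchᵛ v g x)
  switchᵛ-vanishesOutside v g {x = x} x≈0 w w∉S k with w ≟ v
  ... | yes _ = trans (act-cong Γ.refl (x≈0 w w∉S) k) (Act.0-homo g k)
  ... | no  _ = x≈0 w w∉S k

  A-switch : ∀ {v g ψ ψ′} e → ψ′ e Γ.≈ switch Γ src tgt v g ψ e →
             ∀ x → A F Γ d R src tgt ψ e x → A F Γ d R src tgt ψ′ e (switchᵛ v g x)
  A-switch {v} {g} e ψ′e≈ x with src e ≟ tgt e | src e ≟ v | tgt e ≟ v
  ... | yes _ | yes s≡v | yes _ = λ ((α , x≈) , x≈0) →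
    (act g α , λ k →
      trans (switchᵛ-at g x s≡v k) (trans (act-cong Γ.refl x≈ k) (act-I- ψ′e≈ α k))) ,
    switchᵛ-vanishesOutside v g x≈0
  ... | yes s≡t | yes s≡v | no t≢v = contradiction (≡.trans (≡.sym s≡t) s≡v) t≢v
  ... | yes s≡t | no s≢v | yes t≡v = contradiction (≡.trans s≡t t≡v) s≢v
  ... | yes _ | no s≢v | no _ = λ ((α , x≈) , x≈0) →
    (α , λ k →
      trans (switchᵛ-away g x s≢v k) (trans (x≈ k) (I-ρ-cong (Γ.sym ψ′e≈) α k))) ,
    switchᵛ-vanishesOutside v g x≈0
  ... | no s≢t | yes s≡v | yes t≡v = contradiction (≡.trans s≡v (≡.sym t≡v)) s≢t
  ... | no _ | yes s≡v | no t≢v = λ (lift (bal , x≈0)) →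
    lift (Balanced-cong Γ.refl (switchᵛ-at g x s≡v) (switchᵛ-away g x t≢v) (Balanced-∙ˡ ψ′e≈ bal) ,
          switchᵛ-vanishesOutside v g x≈0)
  ... | no _ | no s≢v | yes t≡v = λ (lift (bal , x≈0)) →
    lift (Balanced-cong Γ.refl (switchᵛ-away g x s≢v) (switchᵛ-at g x t≡v) (Balanced-∙⁻¹ʳ ψ′e≈ bal) ,
          switchᵛ-vanishesOutside v g x≈0)
  ... | no _ | no s≢v | no t≢v = λ (lift (bal , x≈0)) →
    lift (Balanced-cong ψ′e≈ (switchᵛ-away g x s≢v) (switchᵛ-away g x t≢v) bal ,
          switchᵛ-vanishesOutside v g x≈0)

  SpanA-switch : ∀ {v g ψ ψ′} → (∀ e → ψ′ e Γ.≈ switch Γ src tgt v g ψ e) →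
                 ∀ x → SpanA F Γ d R src tgt ψ x → SpanA F Γ d R src tgt ψ′ (switchᵛ v g x)
  SpanA-switch {v} {g} ψ′≈ =
    Span-map (switchᵛ-linear v g) (λ x (e , x∈A) → e , A-switch e (ψ′≈ e) x x∈A)

  DimSpanA-switch : ∀ {ψ ψ′} → SwitchStep Γ src tgt ψ ψ′ →
                    ∀ n → DimSpanA F Γ d R src tgt ψ n ⇔ DimSpanA F Γ d R src tgt ψ′ n
  DimSpanA-switch (v , g , ψ′≈) =
    HasDim-transport (switchᵛ-linear v g) (switchᵛ-linear v (g Γ.⁻¹))
      (switchᵛ-cancel v (Γ.inverseˡ g)) (switchᵛ-cancel v (Γ.inverseʳ g))
      (SpanA-switch ψ′≈) (SpanA-switch (λ e → switch-inverse v g e (ψ′≈ e)))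

lemma5p2 : ∀ {c ℓ a b : Level} (F : Field c ℓ) (Γ : Group a b) (d : ℕ)
    (R : Representation F Γ d) (nV nE : ℕ) (src tgt : Fin nE → Fin nV)
    (ψ ψ' : GainFunction Γ src tgt) →
    Equivalent Γ src tgt ψ ψ' →
    ∀ n → DimSpanA F Γ d R src tgt ψ n ⇔ DimSpanA F Γ d R src tgt ψ' n
lemma5p2 F Γ d R nV nE src tgt ψ ψ' ψ~ψ' n =
  Star.fold (λ ψ ψ′ → DimSpanA F Γ d R src tgt ψ n ⇔ DimSpanA F Γ d R src tgt ψ′ n)
            (λ step → ⇔.trans (DimSpanA-switch step n)) ⇔.refl ψ~ψ'
  where
  open SwitchingAction F Γ d R src tgt
  module ⇔ = IsEquivalence ⇔-isEquivalence
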